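{- In the $2$-Labeled Coupon Collector Problem on $n\ge 3$ coupons, the minimal number of samples with which complete recovery can occur is $\left\lceil \frac{2n}{3}\right\rceil$; that is, the smallest value $t$ with $P(T(n)=t)>0$ equals $\left\lceil \frac{2n}{3}\right\rceil$, where $T(n)$ is the number of samples until all $n$ coupons have their labels determined.
   Context: $2$-Labeled Coupon Collector Problem: there are $n$ coupons $C$ and $n$ labels $L$ with an unknown bijection $\sigma:C\to L$. Samples are independent; each sample is a uniformly random $2$-element subset $S\subseteq C$, and the collector observes only the pair of sets $(S,\sigma(S))$, not which label goes with which coupon. The collector has no prior knowledge of $C$ and $L$ beyond what appears in samples. After samples $(S_1,\sigma(S_1)),\dots,(S_t,\sigma(S_t))$, let $C_t=\bigcup_i S_i$, $L_t=\bigcup_i\sigma(S_i)$; a bijection $f:C_t\to L_t$ is consistent if $f(S_i)=\sigma(S_i)$ for all $i$, and a coupon $c$ has its label determined if $c\in C_t$ and all consistent $f$ agree at $c$. $T(n)$ is the least $t$ such that all $n$ coupons have their labels determined. -}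

module Defs where

open import Data.Nat using (ℕ; _<_; _*_; _+_)
open import Data.Nat.DivMod using (_/_)
open import Data.Fin using (Fin)
open import Data.Fin.Permutation using (Permutation′; _⟨$⟩ʳ_)
open import Data.List using (List; length; take)
open import Data.List.Relation.Unary.Any using (Any)
open import Data.List.Relation.Unary.All using (All)
open import Data.Product using (Σ; _×_; _,_; ∃; ∃-syntax)
open import Data.Sum using (_⊎_)
open import Relation.Binary.PropositionalEquality using (_≡_; _≢_)
open import Relation.Nullary using (¬_)

-- A sample: a 2-element subset {a, b} of the coupons Fin n, represented
-- by a pair of distinct coupons (the order carries no information).
record Sample (n : ℕ) : Set where
  constructor sample
  field
    fst : Fin n
    snd : Fin n
    distinct : fst ≢ snd
open Sample public

_∈₂_ : ∀ {n} → Fin n → (Fin n × Fin n) → Set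
x ∈₂ (a , b) = (x ≡ a) ⊎ (x ≡ b)

_≡₂_ : ∀ {n} → (Fin n × Fin n) → (Fin n × Fin n) → Set
(a , b) ≡₂ (c , d) = ((a ≡ c) × (b ≡ d)) ⊎ ((a ≡ d) × (b ≡ c))

couponsOf : ∀ {n} → Sample n → Fin n × Fin n
couponsOf s = (fst s , snd s)

labelsOf : ∀ {n} → Permutation′ n → Sample n → Fin n × Fin n
labelsOf σ s = (σ ⟨$⟩ʳ fst s , σ ⟨$⟩ʳ snd s)

InC : ∀ {n} → List (Sample n) → Fin n → Set
InC ss c = Any (λ s → c ∈₂ couponsOf s) ss

InL : ∀ {n} → Permutation′ n → List (Sample n) → Fin n → Set
InL σ ss ℓ = Any (λ s → ℓ ∈₂ labelsOf σ s) ss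

-- f (represented as a function on all of Fin n, of which only the restriction
-- to C_t matters) is a bijection C_t → L_t with f(S_i) = σ(S_i) for all i.
Consistent : ∀ {n} → Permutation′ n → List (Sample n) → (Fin n → Fin n) → Set
Consistent {n} σ ss f =
    (∀ c → InC ss c → InL σ ss (f c))
  × (∀ c d → InC ss c → InC ss d → f c ≡ f d → c ≡ d)
  × (∀ ℓ → InL σ ss ℓ → ∃[ c ] (InC ss c × f c ≡ ℓ))
  × All (λ s → (f (fst s) , f (snd s)) ≡₂ labelsOf σ s) ss

Determined : ∀ {n} → Permutation′ n → List (Sample n) → Fin n → Set
Determined σ ss c =
  InC ss c × (∀ f g → Consistent σ ss f → Consistent σ ss g → f c ≡ g c)

AllDetermined : ∀ {n} → Permutation′ n → List (Sample n) → Set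
AllDetermined σ ss = ∀ c → Determined σ ss c

-- T(n) = t for the sample sequence whose first t samples are ss:
-- all labels determined after t samples, but not after any k < t samples.
StopsAt : ∀ {n} → Permutation′ n → (t : ℕ) → List (Sample n) → Set
StopsAt σ t ss =
  (length ss ≡ t) × AllDetermined σ ss × (∀ k → k < t → ¬ AllDetermined σ (take k ss))

-- P(T(n) = t) > 0 : every finite sequence of samples has positive probability,
-- so this holds iff some length-t sample sequence realises T(n) = t.
PossibleStop : (n : ℕ) → Permutation′ n → ℕ → Set
PossibleStop n σ t = ∃[ ss ] StopsAt {n} σ t ss

ceil2n/3 : ℕ → ℕ
ceil2n/3 n = (2 * n + 2) / 3

-- Read the samples as the edges of a multigraph on the coupons. If all labels
-- are determined, every coupon lies on an edge, and no edge {a, b} can form a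
-- whole connected component: transposing a and b would give a second consistent
-- bijection. Give a coupon weight 2 if all its edges go to one neighbour and
-- weight 1 otherwise. Every coupon then carries weight × degree ≥ 2, while the two
-- ends of every edge carry weight ≤ 3 together, so double counting gives 2n ≤ 3t,
-- i.e. t ≥ ⌈2n/3⌉. Conversely a star with at least two leaves determines all its
-- labels (the centre gets the only label shared by two spokes), and ⌊n/3⌋
-- disjoint such stars cover n ≥ 3 coupons with exactly ⌈2n/3⌉ edges; since no
-- shorter prefix can determine everything, T(n) = ⌈2n/3⌉ is attained.
module Submission where

open import Defs
open import Data.Nat using (ℕ; zero; suc; _+_; _*_; _⊓_; _≤_; _<_; z≤n; s≤s; s≤s⁻¹)
open import Data.Nat.Properties
  using ( ≤-refl; ≤-reflexive; ≤-trans; ≤-antisym; <⇒≱; +-mono-≤; +-monoʳ-≤; +-monoˡ-≤; +-monoʳ-<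
        ; *-monoˡ-≤; *-distribˡ-+; *-zeroʳ; *-identityʳ; +-identityʳ; *-comm; +-comm; +-assoc; n<1+n; m≤m+n
        ; m⊓n≤m; +-0-commutativeMonoid; module ≤-Reasoning)
open import Data.Nat.DivMod using (m<n*o⇒m/o<n; /-monoˡ-≤; m*n/n≡m)
open import Data.Nat.ListAction using (sum)
open import Data.Bool using (if_then_else_)
open import Data.Bool.Properties using (if-float)
open import Data.Fin using (Fin; zero; suc; _↑ˡ_; _↑ʳ_)
open import Data.Fin.Properties using (_≟_; ↑ˡ-injective; ↑ʳ-injective)
open import Data.Fin.Permutation using (Permutation′; _⟨$⟩ʳ_; _⟨$⟩ˡ_; inverseˡ; inverseʳ)
open import Data.Fin.Permutation.Components using (transpose)
open import Data.List using (List; []; _∷_; [_]; _++_; length; map; take; tabulate; concatMap)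
open import Data.List.Properties using (length-++; length-map; length-take)
open import Data.List.Membership.Propositional using (_∈_; find)
open import Data.List.Relation.Unary.All as All using (All; []; _∷_; all?)
open import Data.List.Relation.Unary.All.Properties using (++⁻; map⁻; tabulate⁻)
open import Data.List.Relation.Unary.Any as Any using (Any; here; there)
import Data.List.Relation.Unary.Any.Properties as Anyₚ
open import Data.Product as Product using (_×_; _,_; proj₁; proj₂; ∃-syntax)
open import Data.Sum as Sum using (_⊎_; inj₁; inj₂)
open import Function using (_∘_; id; case_of_)
open import Function.Definitions using (Injective)
open import Relation.Nullary using (¬_; Dec; yes; no; does; contradiction)
open import Relation.Nullary.Decidable using (dec-true; dec-false; _⊎-dec_)
open import Relation.Binary.PropositionalEquality
  using (_≡_; _≢_; refl; sym; trans; cong; cong₂; subst; _≗_; module ≡-Reasoning)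
open import Algebra.Properties.CommutativeMonoid.Sum +-0-commutativeMonoid
  using (sum-syntax; ∑-distrib-+; sum-cong-≗; sum-replicate-zero)

transpose-matchˡ : ∀ {n} (i j : Fin n) → transpose i j i ≡ j
transpose-matchˡ i j rewrite dec-true (i ≟ i) refl = refl

transpose-matchʳ : ∀ {n} (i j : Fin n) → transpose i j j ≡ i
transpose-matchʳ i j with j ≟ i
... | yes refl = refl
... | no _ rewrite dec-true (j ≟ j) refl = refl

transpose-fixed : ∀ {n} {i j k : Fin n} → k ≢ i → k ≢ j → transpose i j k ≡ k
transpose-fixed {i = i} {j} {k} k≢i k≢j
  rewrite dec-false (k ≟ i) k≢i | dec-false (k ≟ j) k≢j = refl

transpose-involutive : ∀ {n} (i j k : Fin n) → transpose i j (transpose i j k) ≡ k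
transpose-involutive i j k = case k ≟ i of λ where
  (yes refl) → trans (cong (transpose i j) (transpose-matchˡ i j)) (transpose-matchʳ i j)
  (no k≢i)   → case k ≟ j of λ where
    (yes refl) → trans (cong (transpose i j) (transpose-matchʳ i j)) (transpose-matchˡ i j)
    (no k≢j)   → trans (cong (transpose i j) (transpose-fixed k≢i k≢j)) (transpose-fixed k≢i k≢j)

transpose-swaps : ∀ {n} {a b x y : Fin n} → (x , y) ≡₂ (a , b) →
  (transpose a b x , transpose a b y) ≡₂ (x , y)
transpose-swaps {a = a} {b} (inj₁ (refl , refl)) = inj₂ (transpose-matchˡ a b , transpose-matchʳ a b)
transpose-swaps {a = a} {b} (inj₂ (refl , refl)) = inj₂ (transpose-matchʳ a b , transpose-matchˡ a b)

transpose-preserves : ∀ {n} {a b x y : Fin n} →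
  (a ∈₂ (x , y) ⊎ b ∈₂ (x , y) → (x , y) ≡₂ (a , b)) →
  (transpose a b x , transpose a b y) ≡₂ (x , y)
transpose-preserves {a = a} {b} {x} {y} isolated
  with (a ≟ x ⊎-dec a ≟ y) ⊎-dec (b ≟ x ⊎-dec b ≟ y)
... | yes meets = transpose-swaps (isolated meets)
... | no misses = inj₁ ( transpose-fixed (misses ∘ inj₁ ∘ inj₁ ∘ sym) (misses ∘ inj₂ ∘ inj₁ ∘ sym)
                       , transpose-fixed (misses ∘ inj₁ ∘ inj₂ ∘ sym) (misses ∘ inj₂ ∘ inj₂ ∘ sym))

Agrees : ∀ {n m} → (τ f : Fin n → Fin m) → Sample n → Set
Agrees τ f s = (f (fst s) , f (snd s)) ≡₂ (τ (fst s) , τ (snd s))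

≡₂-cong : ∀ {n m} (g : Fin n → Fin m) {a b c d} → (a , b) ≡₂ (c , d) → (g a , g b) ≡₂ (g c , g d)
≡₂-cong g = Sum.map (Product.map (cong g) (cong g)) (Product.map (cong g) (cong g))

∈₂-preserved : ∀ {n} {h : Fin n → Fin n} {x y c} →
  (h x , h y) ≡₂ (x , y) → c ∈₂ (x , y) → h c ∈₂ (x , y)
∈₂-preserved (inj₁ (hx≡x , _))   (inj₁ refl) = inj₁ hx≡x
∈₂-preserved (inj₁ (_ , hy≡y))   (inj₂ refl) = inj₂ hy≡y
∈₂-preserved (inj₂ (hx≡y , _))   (inj₁ refl) = inj₂ hx≡y
∈₂-preserved (inj₂ (_ , hy≡x))   (inj₂ refl) = inj₁ hy≡x

InC-preserved : ∀ {n} {h : Fin n → Fin n} {ss} → All (Agrees id h) ss → ∀ {c} → InC ss c → InC ss (h c)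
InC-preserved (fixed ∷ _)  (here c∈s)  = here (∈₂-preserved fixed c∈s)
InC-preserved (_ ∷ fixeds) (there c∈ss) = there (InC-preserved fixeds c∈ss)

module _ {n : ℕ} (σ : Permutation′ n) where

  σ-injective : Injective _≡_ _≡_ (σ ⟨$⟩ʳ_)
  σ-injective σx≡σy = trans (sym (inverseˡ σ)) (trans (cong (σ ⟨$⟩ˡ_) σx≡σy) (inverseˡ σ))

  InC⇒InL : ∀ {ss c} → InC ss c → InL σ ss (σ ⟨$⟩ʳ c)
  InC⇒InL = Any.map (Sum.map (cong (σ ⟨$⟩ʳ_)) (cong (σ ⟨$⟩ʳ_)))

  InL⇒InC : ∀ {ss ℓ} → InL σ ss ℓ → InC ss (σ ⟨$⟩ˡ ℓ)
  InL⇒InC = Any.map (Sum.map invert invert)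
    where
    invert : ∀ {ℓ x} → ℓ ≡ σ ⟨$⟩ʳ x → σ ⟨$⟩ˡ ℓ ≡ x
    invert refl = inverseˡ σ

  consistent-∘ : ∀ {ss} (h : Fin n → Fin n) → (∀ c → h (h c) ≡ c) →
    All (Agrees id h) ss → Consistent σ ss (λ c → σ ⟨$⟩ʳ h c)
  consistent-∘ h h-involutive fixes =
      (λ _ c∈ → InC⇒InL (InC-preserved fixes c∈))
    , (λ c d _ _ σhc≡σhd → h-injective (σ-injective σhc≡σhd))
    , (λ ℓ ℓ∈ → h (σ ⟨$⟩ˡ ℓ) , InC-preserved fixes (InL⇒InC ℓ∈)
                , trans (cong (σ ⟨$⟩ʳ_) (h-involutive _)) (inverseʳ σ))
    , All.map (≡₂-cong (σ ⟨$⟩ʳ_)) fixes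
    where
    h-injective : ∀ {c d} → h c ≡ h d → c ≡ d
    h-injective {c} {d} hc≡hd = trans (sym (h-involutive c)) (trans (cong h hc≡hd) (h-involutive d))

  consistent-σ : ∀ {ss} → Consistent σ ss (σ ⟨$⟩ʳ_)
  consistent-σ = consistent-∘ id (λ _ → refl) (All.tabulate (λ _ → inj₁ (refl , refl)))

module _ {n : ℕ} where

  neighboursIn : Fin n → Sample n → List (Fin n)
  neighboursIn v s =
    (if does (v ≟ fst s) then [ snd s ] else []) ++ (if does (v ≟ snd s) then [ fst s ] else [])

  neighbours : Fin n → List (Sample n) → List (Fin n)
  neighbours v = concatMap (neighboursIn v)

  snd∈neighbours-fst : ∀ {s ss} → s ∈ ss → snd s ∈ neighbours (fst s) ss
  snd∈neighbours-fst {s} s∈ = Anyₚ.concatMap⁺ _ (Any.map (λ { refl → snd∈ }) s∈)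
    where
    snd∈ : snd s ∈ neighboursIn (fst s) s
    snd∈ rewrite dec-true (fst s ≟ fst s) refl = here refl

  fst∈neighbours-snd : ∀ {s ss} → s ∈ ss → fst s ∈ neighbours (snd s) ss
  fst∈neighbours-snd {s} s∈ = Anyₚ.concatMap⁺ _ (Any.map (λ { refl → fst∈ }) s∈)
    where
    fst∈ : fst s ∈ neighboursIn (snd s) s
    fst∈ rewrite dec-false (snd s ≟ fst s) (distinct s ∘ sym) | dec-true (snd s ≟ snd s) refl =
      here refl

  other-endpoint : ∀ {v s ss} → s ∈ ss → v ∈₂ couponsOf s →
    ∃[ u ] (u ∈ neighbours v ss × couponsOf s ≡₂ (v , u))
  other-endpoint {s = s} s∈ (inj₁ refl) = snd s , snd∈neighbours-fst s∈ , inj₁ (refl , refl)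
  other-endpoint {s = s} s∈ (inj₂ refl) = fst s , fst∈neighbours-snd s∈ , inj₂ (refl , refl)

  covered⇒neighbour : ∀ {v ss} → InC ss v → ∃[ u ] u ∈ neighbours v ss
  covered⇒neighbour v∈ =
    let _ , s∈ , v∈s = find v∈
        u , u∈ , _   = other-endpoint s∈ v∈s
    in u , u∈

  sole-neighbour⇒isolated : ∀ {a b ss} → All (b ≡_) (neighbours a ss) →
    ∀ {s} → s ∈ ss → a ∈₂ couponsOf s → couponsOf s ≡₂ (a , b)
  sole-neighbour⇒isolated {a} sole s∈ a∈s =
    let u , u∈ , s≡au = other-endpoint s∈ a∈s
    in subst (λ u → _ ≡₂ (a , u)) (sym (All.lookup sole u∈)) s≡au

-- Double counting

δ : ∀ {n} → Fin n → Fin n → ℕ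
δ v x = if does (v ≟ x) then 1 else 0

length-neighboursIn : ∀ {n} (v : Fin n) s → length (neighboursIn v s) ≡ δ v (fst s) + δ v (snd s)
length-neighboursIn v s = trans (length-++ (if does (v ≟ fst s) then [ snd s ] else []))
  (cong₂ _+_ (if-float length (does (v ≟ fst s))) (if-float length (does (v ≟ snd s))))

∑-mono-≤ : ∀ {n} {f g : Fin n → ℕ} → (∀ i → f i ≤ g i) → ∑[ i < n ] f i ≤ ∑[ i < n ] g i
∑-mono-≤ {zero}  _   = z≤n
∑-mono-≤ {suc n} f≤g = +-mono-≤ (f≤g zero) (∑-mono-≤ (f≤g ∘ suc))

∑-const : ∀ n c → ∑[ i < n ] c ≡ n * c
∑-const zero    c = refl
∑-const (suc n) c = cong (c +_) (∑-const n c)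

∑-*-zeroʳ : ∀ {n} (w : Fin n → ℕ) → ∑[ v < n ] (w v * 0) ≡ 0
∑-*-zeroʳ {n} w = trans (sum-cong-≗ (λ v → *-zeroʳ (w v))) (sum-replicate-zero n)

∑-*-distribˡ-+ : ∀ {n} (w f g : Fin n → ℕ) →
  ∑[ v < n ] (w v * (f v + g v)) ≡ ∑[ v < n ] (w v * f v) + ∑[ v < n ] (w v * g v)
∑-*-distribˡ-+ w f g = trans (sum-cong-≗ (λ v → *-distribˡ-+ (w v) (f v) (g v)))
  (∑-distrib-+ (λ v → w v * f v) (λ v → w v * g v))

∑-*-δ : ∀ {n} (w : Fin n → ℕ) x → ∑[ v < n ] (w v * δ v x) ≡ w x
∑-*-δ w zero    = trans (cong₂ _+_ (*-identityʳ (w zero)) (∑-*-zeroʳ (w ∘ suc))) (+-identityʳ (w zero))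
∑-*-δ {suc n} w (suc x) =
  trans (cong (_+ ∑[ v < n ] (w (suc v) * δ v x)) (*-zeroʳ (w zero))) (∑-*-δ (w ∘ suc) x)

degree-sum : ∀ {n} (w : Fin n → ℕ) ss →
  ∑[ v < n ] (w v * length (neighbours v ss)) ≡ sum (map (λ s → w (fst s) + w (snd s)) ss)
degree-sum w []       = ∑-*-zeroʳ w
degree-sum {n} w (s ∷ ss) = begin
  ∑[ v < n ] (w v * length (neighbours v (s ∷ ss)))
    ≡⟨ sum-cong-≗ (λ v → cong (w v *_) (trans (length-++ (neighboursIn v s))
                                                (cong (_+ _) (length-neighboursIn v s)))) ⟩
  ∑[ v < n ] (w v * ((δ v (fst s) + δ v (snd s)) + length (neighbours v ss)))
    ≡⟨ ∑-*-distribˡ-+ w _ _ ⟩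
  ∑[ v < n ] (w v * (δ v (fst s) + δ v (snd s))) + ∑[ v < n ] (w v * length (neighbours v ss))
    ≡⟨ cong₂ _+_ (trans (∑-*-distribˡ-+ w _ _) (cong₂ _+_ (∑-*-δ w (fst s)) (∑-*-δ w (snd s))))
                 (degree-sum w ss) ⟩
  (w (fst s) + w (snd s)) + sum (map (λ s → w (fst s) + w (snd s)) ss)
    ∎
  where open ≡-Reasoning

sum-map-≤ : ∀ {A : Set} {g : A → ℕ} {c} {xs : List A} → All (λ x → g x ≤ c) xs →
  sum (map g xs) ≤ length xs * c
sum-map-≤ []           = z≤n
sum-map-≤ (gx≤c ∷ g≤c) = +-mono-≤ gx≤c (sum-map-≤ g≤c)

Constant : ∀ {A : Set} → List A → Set
Constant xs = All (λ x → All (x ≡_) xs) xs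

constant? : ∀ {n} (xs : List (Fin n)) → Dec (Constant xs)
constant? xs = all? (λ x → all? (x ≟_) xs) xs

weight : ∀ {n} → List (Fin n) → ℕ
weight xs = if does (constant? xs) then 2 else 1

weight-constant : ∀ {n} {xs : List (Fin n)} → Constant xs → weight xs ≡ 2
weight-constant {xs = xs} constant = cong (λ b → if b then 2 else 1) (dec-true (constant? xs) constant)

1≤weight : ∀ {n} (xs : List (Fin n)) → 1 ≤ weight xs
1≤weight xs with constant? xs
... | yes _ = s≤s z≤n
... | no _  = s≤s z≤n

weight*length≥2 : ∀ {n} {u : Fin n} xs → u ∈ xs → 2 ≤ weight xs * length xs
weight*length≥2 (x ∷ [])     _ =
  ≤-reflexive (cong (_* 1) (sym (weight-constant {xs = [ x ]} ((refl ∷ []) ∷ []))))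
weight*length≥2 (x ∷ y ∷ xs) _ =
  ≤-trans (s≤s (s≤s z≤n)) (*-monoˡ-≤ (2 + length xs) (1≤weight (x ∷ y ∷ xs)))

weight+weight≤3 : ∀ {n} (xs ys : List (Fin n)) → ¬ (Constant xs × Constant ys) →
  weight xs + weight ys ≤ 3
weight+weight≤3 xs ys not-both with constant? xs | constant? ys
... | yes cx | yes cy = contradiction (cx , cy) not-both
... | yes _  | no _   = ≤-refl
... | no _   | yes _  = ≤-refl
... | no _   | no _   = s≤s (s≤s z≤n)

-- The lower bound

module _ {n : ℕ} (σ : Permutation′ n) {ss : List (Sample n)} (determined : AllDetermined σ ss) where

  no-isolated-edge : ∀ {s} → s ∈ ss →
    ¬ (Constant (neighbours (fst s) ss) × Constant (neighbours (snd s) ss))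
  no-isolated-edge {s} s∈ (constant-a , constant-b) = distinct s (sym b≡a)
    where
    a = fst s
    b = snd s
    isolated : ∀ {t} → t ∈ ss → a ∈₂ couponsOf t ⊎ b ∈₂ couponsOf t → couponsOf t ≡₂ (a , b)
    isolated t∈ (inj₁ a∈t) =
      sole-neighbour⇒isolated (All.lookup constant-a (snd∈neighbours-fst s∈)) t∈ a∈t
    isolated t∈ (inj₂ b∈t) =
      Sum.swap (sole-neighbour⇒isolated (All.lookup constant-b (fst∈neighbours-snd s∈)) t∈ b∈t)
    swapped-consistent : Consistent σ ss (λ c → σ ⟨$⟩ʳ transpose a b c)
    swapped-consistent = consistent-∘ σ (transpose a b) (transpose-involutive a b)
      (All.tabulate (λ t∈ → transpose-preserves (isolated t∈)))
    b≡a : b ≡ a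
    b≡a = σ-injective σ (trans (cong (σ ⟨$⟩ʳ_) (sym (transpose-matchˡ a b)))
                               (proj₂ (determined a) _ _ swapped-consistent (consistent-σ σ)))

  weight-at : Fin n → ℕ
  weight-at v = weight (neighbours v ss)

  lower-bound : 2 * n ≤ 3 * length ss
  lower-bound = begin
    2 * n                                                        ≡⟨ *-comm 2 n ⟩
    n * 2                                                        ≡⟨ ∑-const n 2 ⟨
    ∑[ v < n ] 2                                                 ≤⟨ ∑-mono-≤ covered-weight ⟩
    ∑[ v < n ] (weight-at v * length (neighbours v ss))          ≡⟨ degree-sum weight-at ss ⟩
    sum (map (λ s → weight-at (fst s) + weight-at (snd s)) ss)  ≤⟨ sum-map-≤ edge-weights ⟩
    length ss * 3                                                ≡⟨ *-comm (length ss) 3 ⟩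
    3 * length ss                                                ∎
    where
    open ≤-Reasoning
    covered-weight : ∀ v → 2 ≤ weight-at v * length (neighbours v ss)
    covered-weight v = weight*length≥2 _ (proj₂ (covered⇒neighbour (proj₁ (determined v))))
    edge-weights : All (λ s → weight-at (fst s) + weight-at (snd s) ≤ 3) ss
    edge-weights = All.tabulate (λ s∈ → weight+weight≤3 _ _ (no-isolated-edge s∈))

ceil2n/3-≤ : ∀ {n t} → 2 * n ≤ 3 * t → ceil2n/3 n ≤ t
ceil2n/3-≤ {n} {t} 2n≤3t = s≤s⁻¹ (m<n*o⇒m/o<n (begin-strict
  2 * n + 2  <⟨ +-monoʳ-< (2 * n) (n<1+n 2) ⟩
  2 * n + 3  ≤⟨ +-monoˡ-≤ 3 2n≤3t ⟩
  3 * t + 3  ≡⟨ +-comm (3 * t) 3 ⟩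
  3 + 3 * t  ≡⟨ cong (3 +_) (*-comm 3 t) ⟩
  suc t * 3  ∎))
  where open ≤-Reasoning

≤-ceil2n/3 : ∀ {n t} → 3 * t ≤ 2 * n + 2 → t ≤ ceil2n/3 n
≤-ceil2n/3 {n} {t} 3t≤2n+2 =
  subst (_≤ ceil2n/3 n) (m*n/n≡m t 3) (/-monoˡ-≤ 3 (subst (_≤ 2 * n + 2) (*-comm 3 t) 3t≤2n+2))

ceil2n/3≤length : ∀ {n} (σ : Permutation′ n) {ss} → AllDetermined σ ss → ceil2n/3 n ≤ length ss
ceil2n/3≤length {n} σ determined = ceil2n/3-≤ {n} (lower-bound σ determined)

-- Sample sequences that determine every label

Covers : ∀ {n} → List (Sample n) → Set
Covers {n} ss = (v : Fin n) → InC ss v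

-- The codomain is left free so that each block of a disjoint union ⊕ can be treated on its own.
Rigid : ∀ {n} → List (Sample n) → Set
Rigid {n} ss = ∀ {m} (τ f : Fin n → Fin m) → Injective _≡_ _≡_ τ → All (Agrees τ f) ss → f ≗ τ

allDetermined : ∀ {n} (σ : Permutation′ n) {ss} → Covers ss → Rigid ss → AllDetermined σ ss
allDetermined σ covers rigid c =
  covers c , λ f g (_ , _ , _ , f-agrees) (_ , _ , _ , g-agrees) →
    trans (rigid _ f (σ-injective σ) f-agrees c) (sym (rigid _ g (σ-injective σ) g-agrees c))

module _ {n m} {τ f : Fin n → Fin m} (τ-injective : Injective _≡_ _≡_ τ) where

  agrees-at-hub : ∀ {x y z} → y ≢ z →
    (f x , f y) ≡₂ (τ x , τ y) → (f x , f z) ≡₂ (τ x , τ z) → f x ≡ τ x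
  agrees-at-hub _ (inj₁ (fx≡τx , _)) _ = fx≡τx
  agrees-at-hub _ (inj₂ _) (inj₁ (fx≡τx , _)) = fx≡τx
  agrees-at-hub y≢z (inj₂ (fx≡τy , _)) (inj₂ (fx≡τz , _)) =
    contradiction (τ-injective (trans (sym fx≡τy) fx≡τz)) y≢z

  agrees-along : ∀ {x y} → x ≢ y → (f x , f y) ≡₂ (τ x , τ y) → f x ≡ τ x → f y ≡ τ y
  agrees-along _ (inj₁ (_ , fy≡τy)) _ = fy≡τy
  agrees-along x≢y (inj₂ (fx≡τy , _)) fx≡τx =
    contradiction (τ-injective (trans (sym fx≡τx) fx≡τy)) x≢y

spoke : ∀ {k} → Fin k → Sample (suc k)
spoke i = sample zero (suc i) (λ ())

star : ∀ k → List (Sample (suc k))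
star k = tabulate spoke

covers-star : ∀ {k} → Covers (star (suc k))
covers-star zero    = Anyₚ.tabulate⁺ {f = spoke} zero (inj₁ refl)
covers-star (suc i) = Anyₚ.tabulate⁺ {f = spoke} i (inj₂ refl)

rigid-star : ∀ {k} → Rigid (star (suc (suc k)))
rigid-star τ f τ-injective agrees = λ where
    zero    → centre
    (suc i) → agrees-along {f = f} τ-injective (λ ()) (spokes i) centre
  where
  spokes : ∀ i → Agrees τ f (spoke i)
  spokes = tabulate⁻ {f = spoke} agrees
  centre : f zero ≡ τ zero
  centre = agrees-at-hub {f = f} τ-injective (λ ()) (spokes zero) (spokes (suc zero))

liftˡ : ∀ {a} b → Sample a → Sample (a + b)
liftˡ b s = sample (fst s ↑ˡ b) (snd s ↑ˡ b) (distinct s ∘ ↑ˡ-injective b _ _)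

liftʳ : ∀ a {b} → Sample b → Sample (a + b)
liftʳ a s = sample (a ↑ʳ fst s) (a ↑ʳ snd s) (distinct s ∘ ↑ʳ-injective a _ _)

_⊕_ : ∀ {a b} → List (Sample a) → List (Sample b) → List (Sample (a + b))
_⊕_ {a} {b} ss ts = map (liftˡ b) ss ++ map (liftʳ a) ts

length-⊕ : ∀ {a b} (ss : List (Sample a)) (ts : List (Sample b)) →
  length (ss ⊕ ts) ≡ length ss + length ts
length-⊕ {a} {b} ss ts = trans (length-++ (map (liftˡ b) ss))
  (cong₂ _+_ (length-map (liftˡ b) ss) (length-map (liftʳ a) ts))

↑-elim : ∀ a {b} {P : Fin (a + b) → Set} → (∀ i → P (i ↑ˡ b)) → (∀ j → P (a ↑ʳ j)) → ∀ v → P v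
↑-elim zero    _    right v       = right v
↑-elim (suc a) left _     zero    = left zero
↑-elim (suc a) {P = P} left right (suc v) = ↑-elim a {P = P ∘ suc} (left ∘ suc) right v

covers-⊕ : ∀ {a b} {ss : List (Sample a)} {ts : List (Sample b)} →
  Covers ss → Covers ts → Covers (ss ⊕ ts)
covers-⊕ {a} {b} {ss} covers-ss covers-ts = ↑-elim a
  (λ i → Anyₚ.++⁺ˡ (Anyₚ.map⁺ (Any.map (Sum.map (cong (_↑ˡ b)) (cong (_↑ˡ b))) (covers-ss i))))
  (λ j → Anyₚ.++⁺ʳ (map (liftˡ b) ss)
           (Anyₚ.map⁺ (Any.map (Sum.map (cong (a ↑ʳ_)) (cong (a ↑ʳ_))) (covers-ts j))))

rigid-⊕ : ∀ {a b} {ss : List (Sample a)} {ts : List (Sample b)} →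
  Rigid ss → Rigid ts → Rigid (ss ⊕ ts)
rigid-⊕ {a} {b} {ss} rigid-ss rigid-ts τ f τ-injective agrees =
  let agreesˡ , agreesʳ = ++⁻ (map (liftˡ b) ss) agrees in
  ↑-elim a
    (rigid-ss (τ ∘ (_↑ˡ b)) (f ∘ (_↑ˡ b)) (λ e → ↑ˡ-injective b _ _ (τ-injective e)) (map⁻ agreesˡ))
    (rigid-ts (τ ∘ (a ↑ʳ_)) (f ∘ (a ↑ʳ_)) (λ e → ↑ʳ-injective a _ _ (τ-injective e)) (map⁻ agreesʳ))

3*[2+t]≤2*[3+k]+2 : ∀ {t k} → 3 * t ≤ 2 * k + 2 → 3 * (2 + t) ≤ 2 * (3 + k) + 2
3*[2+t]≤2*[3+k]+2 {t} {k} 3t≤2k+2 = begin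
  3 * (2 + t)      ≡⟨ *-distribˡ-+ 3 2 t ⟩
  6 + 3 * t        ≤⟨ +-monoʳ-≤ 6 3t≤2k+2 ⟩
  6 + (2 * k + 2)  ≡⟨ +-assoc 6 (2 * k) 2 ⟨
  6 + 2 * k + 2    ≡⟨ cong (_+ 2) (*-distribˡ-+ 2 3 k) ⟨
  2 * (3 + k) + 2  ∎
  where open ≤-Reasoning

determining-samples : ∀ m →
  ∃[ ss ] (3 * length ss ≤ 2 * (3 + m) + 2 × Covers {3 + m} ss × Rigid ss)
determining-samples 0 = star 2 , m≤m+n 6 2 , covers-star , rigid-star
determining-samples 1 = star 3 , m≤m+n 9 1 , covers-star , rigid-star
determining-samples 2 = star 4 , ≤-refl , covers-star , rigid-star
determining-samples (suc (suc (suc m))) =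
  let ss , short , covers , rigid = determining-samples m in
    star 2 ⊕ ss
  , subst (λ ℓ → 3 * ℓ ≤ 2 * (6 + m) + 2) (sym (length-⊕ (star 2) ss))
          (3*[2+t]≤2*[3+k]+2 {k = 3 + m} short)
  , covers-⊕ covers-star covers
  , rigid-⊕ rigid-star rigid

stops-at-ceil2n/3 : ∀ {n} (σ : Permutation′ n) ss → 3 * length ss ≤ 2 * n + 2 →
  AllDetermined σ ss → StopsAt σ (ceil2n/3 n) ss
stops-at-ceil2n/3 {n} σ ss short determined =
  ≤-antisym (≤-ceil2n/3 {n} short) (ceil2n/3≤length σ determined) , determined , prefix-undetermined
  where
  prefix-undetermined : ∀ k → k < ceil2n/3 n → ¬ AllDetermined σ (take k ss)
  prefix-undetermined k k<ceil prefix-determined = <⇒≱ k<ceil (begin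
    ceil2n/3 n             ≤⟨ ceil2n/3≤length σ prefix-determined ⟩
    length (take k ss)     ≡⟨ length-take k ss ⟩
    k ⊓ length ss          ≤⟨ m⊓n≤m k (length ss) ⟩
    k                      ∎)
    where open ≤-Reasoning

claim2 : (n : ℕ) → 3 ≤ n → (σ : Permutation′ n) →
    PossibleStop n σ (ceil2n/3 n) × (∀ t → PossibleStop n σ t → ceil2n/3 n ≤ t)
claim2 (suc (suc (suc m))) (s≤s (s≤s (s≤s z≤n))) σ =
  let ss , short , covers , rigid = determining-samples m in
    (ss , stops-at-ceil2n/3 σ ss short (allDetermined σ covers rigid))
  , λ t (ts , length≡t , determined , _) → subst (ceil2n/3 (3 + m) ≤_) length≡t (ceil2n/3≤length σ determined)
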